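{- Let $a_0,\ldots,a_{15}\in\mathbb{Z}$, $\bm a=(a_0,\ldots,a_{15})$, and define $b_i=(a_i+a_{i+8})+(a_{i+4}+a_{i+12})$, $c_i=(a_i+a_{i+8})-(a_{i+4}+a_{i+12})$ ($0\le i\le 3$), $d_i=a_i-a_{i+8}$ ($0\le i\le 7$), $\bm b=(b_0,\ldots,b_3)$, $\bm c=(c_0,\ldots,c_3)$, $\bm d=(d_0,\ldots,d_7)$. Then $D_G(\bm a)\equiv D_4(\bm b)\equiv D_4(\bm c)\equiv F(\bm d)\pmod 2$.
   Context: $G={\rm C}_4\rtimes{\rm C}_4=\langle g_1,g_2\mid g_1^4=g_2^4=e,\ g_2g_1=g_1^3g_2\rangle$. For $g=g_1^sg_2^t$ ($0\le s,t\le3$) the variable $z_g$ is written $z_{t+4s}$ and $D_G(z_0,\ldots,z_{15})=\det(z_{gh^{ -1}})_{g,h\in G}$. $D_4(x_0,x_1,x_2,x_3)=\det(x_{gh^{ -1}})_{g,h\in{\rm C}_4}$ with $x_{\bar r}$ written $x_r$. With $f_k(x,y,z,w)=x^2+y^2+(-1)^kz^2+(-1)^kw^2$ ($k=0,1$), $F(w_0,\ldots,w_7)=f_0(w_0-w_2,w_4-w_6,w_1-w_3,w_5-w_7)f_1(w_0+w_2,w_4+w_6,w_1+w_3,w_5+w_7)$. -}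

module Defs where

open import Data.Nat as ℕ using (ℕ; zero; suc)
open import Data.Nat.DivMod using (_mod_; _/_; _%_)
open import Data.Fin using (Fin; zero; suc; toℕ; punchIn)
open import Data.Integer using (ℤ; +_; -_; _+_; _-_; _*_; 1ℤ; 0ℤ)
open import Data.Integer.Divisibility using (_∣_)

_≡₂_ : ℤ → ℤ → Set
x ≡₂ y = (+ 2) ∣ (x - y)
infix 4 _≡₂_

sumFin : (n : ℕ) → (Fin n → ℤ) → ℤ
sumFin zero f = 0ℤ
sumFin (suc n) f = f zero + sumFin n (λ i → f (suc i))

sgn : ℕ → ℤ
sgn zero = 1ℤ
sgn (suc k) = - sgn k

det : (n : ℕ) → (Fin n → Fin n → ℤ) → ℤ
det zero M = 1ℤ
det (suc n) M =
  sumFin (suc n) (λ j → sgn (toℕ j) * (M zero j * det n (λ i k → M (suc i) (punchIn j k))))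

-- C4 ⋊ C4 : element g1^s g2^t (0 ≤ s,t ≤ 3) has index t + 4s.
sOf tOf : Fin 16 → ℕ
sOf k = toℕ k / 4
tOf k = toℕ k % 4

-- (-1)^t * s mod 4, as a natural number in [0,4)
twist : ℕ → ℕ → ℕ
twist t s = if-even t
  where
  if-even : ℕ → ℕ
  if-even zero = s
  if-even (suc zero) = 3 ℕ.* s
  if-even (suc (suc t')) = if-even t'

idx : ℕ → ℕ → Fin 16
idx s t = ((t % 4) ℕ.+ 4 ℕ.* (s % 4)) mod 16

-- (g1^s1 g2^t1)(g1^s2 g2^t2) = g1^(s1 + (-1)^t1 s2) g2^(t1+t2)
mulG : Fin 16 → Fin 16 → Fin 16
mulG g h = idx (sOf g ℕ.+ twist (tOf g) (sOf h)) (tOf g ℕ.+ tOf h)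

-- (g1^s g2^t)^{-1} = g1^(-(-1)^t s) g2^(-t)
invG : Fin 16 → Fin 16
invG g = idx (twist (tOf g) (3 ℕ.* sOf g)) (3 ℕ.* tOf g)

D-G : (Fin 16 → ℤ) → ℤ
D-G z = det 16 (λ g h → z (mulG g (invG h)))

D-4 : (Fin 4 → ℤ) → ℤ
D-4 x = det 4 (λ g h → x ((toℕ g ℕ.+ 3 ℕ.* toℕ h) mod 4))

f₀ f₁ : ℤ → ℤ → ℤ → ℤ → ℤ
f₀ x y z w = x * x + y * y + z * z + w * w
f₁ x y z w = x * x + y * y - z * z - w * w

F : (Fin 8 → ℤ) → ℤ
F w = f₀ (w' 0 - w' 2) (w' 4 - w' 6) (w' 1 - w' 3) (w' 5 - w' 7)
    * f₁ (w' 0 + w' 2) (w' 4 + w' 6) (w' 1 + w' 3) (w' 5 + w' 7)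
  where
  w' : ℕ → ℤ
  w' n = w (n mod 8)

ix16 : ℕ → Fin 16
ix16 n = n mod 16

{-# OPTIONS --safe #-}
-- Modulo 2 every determinant becomes a determinant over 𝔽₂, where signs disappear, and the
-- group determinant becomes the determinant of multiplication by x = Σ a_g g on 𝔽₂[G].
-- For G = C₄ ⋊ C₄ the basis (1 + g₁)^v (1 + g₂)^u of 𝔽₂[G] makes every group element act
-- by an upper unitriangular matrix (G is a 2-group, so its elements act unipotently).  Hence
-- x is conjugate to an upper triangular matrix with diagonal Σ a_g, and
-- D_G(a) ≡ (Σ a_g)^|G| ≡ Σ a_g.  The same argument for C₄ gives D₄(b) ≡ Σ b_i and
-- D₄(c) ≡ Σ c_i, while F(d), a product of two sums of four squares, is ≡ (Σ d_i)² ≡ Σ d_i.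
-- Finally Σ b_i, Σ c_i and Σ d_i are all ≡ Σ a_g.
module Submission where

open import Defs
open import Data.Nat using (ℕ)
open import Data.Fin using (Fin; toℕ)
open import Data.Integer using (ℤ; _+_; _-_)
open import Data.Product using (_×_)

open import Algebra.Bundles using (CommutativeRing)
import Algebra.Properties.CommutativeSemigroup as CommutativeSemigroupProperties
open import Algebra.Solver.Ring.AlmostCommutativeRing using (fromCommutativeRing)
import Algebra.Solver.Ring.Simple as RingSolver
open import Data.Bool using (Bool; true; false; _xor_; _∧_)
open import Data.Bool.Properties
  using ( xor-∧-commutativeRing; xor-assoc; xor-same; xor-identityʳ; ∧-distribˡ-xor; ∧-distribʳ-xor
        ; ∧-zeroʳ; ∧-identityʳ; ∧-assoc; ∧-comm; ∧-idem )
import Data.Bool.Properties as Bool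
open import Data.Fin using (zero; suc; punchIn; lift; _<_; _<?_; #_)
open import Data.Fin.Properties using (_≟_; all?)
open import Data.Integer using (+_; -_; _*_; 0ℤ; 1ℤ)
open import Data.Integer.DivMod using (_%ℕ_; _/ℕ_; a≡a%ℕn+[a/ℕn]*n; n%ℕd<d)
import Data.Integer.Divisibility.Signed as Signed
open import Data.Integer.Solver using (module +-*-Solver)
open import Data.List using (List; []; _∷_)
import Data.List as List
open import Data.List.Relation.Unary.All using (All; []; _∷_)
import Data.List.Relation.Unary.All as All
import Data.Nat as ℕ
open import Data.Nat using (zero; suc; s≤s; z≤n; _≡ᵇ_)
open import Data.Nat.Combinatorics using (_C_)
open import Data.Nat.DivMod using (_mod_; _%_)
open import Data.Nat.Divisibility using (∣⇒≤)
open import Data.Nat.Properties using (+-comm; +-assoc)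
open import Data.Product using (_,_; proj₁; proj₂; uncurry)
open import Data.Vec.Functional using (Vector; tail; updateAt; zipWith)
import Data.Vec.Functional as Vector
open import Data.Vec.Functional.Properties using (updateAt-updates; updateAt-minimal; updateAt-id-local; map-updateAt)
open import Function using (_∘_; const)
open import Relation.Binary.PropositionalEquality
open import Relation.Nullary using (Dec; yes; no; ¬?; contradiction)
open import Relation.Nullary.Decidable using (from-yes; _×-dec_; _→-dec_)

private
  variable
    m n : ℕ

open CommutativeRing xor-∧-commutativeRing
  using (semiring; *-commutativeSemigroup; +-commutativeSemigroup)
open import Algebra.Properties.Semiring.Sum semiring
  using (sum; sum-cong-≗; sum-replicate-zero; ∑-distrib-+; ∑-comm; *-distribˡ-sum; *-distribʳ-sum)
module ∧ = CommutativeSemigroupProperties *-commutativeSemigroup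
module ⊕ = CommutativeSemigroupProperties +-commutativeSemigroup

-- Reduction modulo 2

⟦_⟧ : Bool → ℤ
⟦ false ⟧ = 0ℤ
⟦ true ⟧ = 1ℤ

parity : ℤ → Bool
parity x = x %ℕ 2 ≡ᵇ 1

Even : ℤ → Set
Even x = + 2 Signed.∣ x

⟦parity⟧ : ∀ x → ⟦ parity x ⟧ ≡ + (x %ℕ 2)
⟦parity⟧ x with x %ℕ 2 | n%ℕd<d x 2
... | 0 | _ = refl
... | 1 | _ = refl
... | suc (suc _) | s≤s (s≤s ())

module _ where
  open +-*-Solver using (solve; _:=_; _:+_; _:-_; _:*_; :-_; con)

  parity-spec : ∀ x → Even (x - ⟦ parity x ⟧)
  parity-spec x = Signed.divides (x /ℕ 2) (begin
    x - ⟦ parity x ⟧                              ≡⟨ cong₂ _-_ (a≡a%ℕn+[a/ℕn]*n x 2) (⟦parity⟧ x) ⟩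
    (+ (x %ℕ 2) + x /ℕ 2 * + 2) - + (x %ℕ 2)     ≡⟨ solve 2 (λ r q → (r :+ q :* con (+ 2)) :- r := q :* con (+ 2)) refl (+ (x %ℕ 2)) (x /ℕ 2) ⟩
    x /ℕ 2 * + 2                                  ∎)
    where open ≡-Reasoning

  ⟦⟧-injective-mod-2 : ∀ b c → Even (⟦ b ⟧ - ⟦ c ⟧) → b ≡ c
  ⟦⟧-injective-mod-2 false false _ = refl
  ⟦⟧-injective-mod-2 true  true  _ = refl
  ⟦⟧-injective-mod-2 true  false 2∣1 with ∣⇒≤ (Signed.∣⇒∣ᵤ 2∣1)
  ... | s≤s ()
  ⟦⟧-injective-mod-2 false true 2∣-1 with ∣⇒≤ (Signed.∣⇒∣ᵤ 2∣-1)
  ... | s≤s ()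

  parity-unique : ∀ x b → Even (x - ⟦ b ⟧) → parity x ≡ b
  parity-unique x b 2∣x-b = ⟦⟧-injective-mod-2 (parity x) b
    (subst Even (solve 3 (λ x p b → (x :- b) :- (x :- p) := p :- b) refl x ⟦ parity x ⟧ ⟦ b ⟧)
      (Signed.∣m∣n⇒∣m-n 2∣x-b (parity-spec x)))

  ⟦⟧-xor : ∀ b c → Even (⟦ b ⟧ + ⟦ c ⟧ - ⟦ b xor c ⟧)
  ⟦⟧-xor true  true  = Signed.divides 1ℤ refl
  ⟦⟧-xor true  false = Signed.divides 0ℤ refl
  ⟦⟧-xor false true  = Signed.divides 0ℤ refl
  ⟦⟧-xor false false = Signed.divides 0ℤ refl

  ⟦⟧-∧ : ∀ b c → Even (⟦ b ⟧ * ⟦ c ⟧ - ⟦ b ∧ c ⟧)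
  ⟦⟧-∧ true  true  = Signed.divides 0ℤ refl
  ⟦⟧-∧ true  false = Signed.divides 0ℤ refl
  ⟦⟧-∧ false c     = Signed.divides 0ℤ refl

  parity-+ : ∀ x y → parity (x + y) ≡ parity x xor parity y
  parity-+ x y = parity-unique (x + y) (p xor q) (subst Even
    (solve 5 (λ x y p q r → ((x :- p) :+ (y :- q)) :+ ((p :+ q) :- r) := (x :+ y) :- r) refl x y ⟦ p ⟧ ⟦ q ⟧ ⟦ p xor q ⟧)
    (Signed.∣m∣n⇒∣m+n (Signed.∣m∣n⇒∣m+n (parity-spec x) (parity-spec y)) (⟦⟧-xor p q)))
    where p = parity x ; q = parity y

  parity-* : ∀ x y → parity (x * y) ≡ parity x ∧ parity y
  parity-* x y = parity-unique (x * y) (p ∧ q) (subst Even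
    (solve 5 (λ x y p q r → ((x :- p) :* y :+ p :* (y :- q)) :+ (p :* q :- r) := x :* y :- r) refl x y ⟦ p ⟧ ⟦ q ⟧ ⟦ p ∧ q ⟧)
    (Signed.∣m∣n⇒∣m+n (Signed.∣m∣n⇒∣m+n (Signed.∣m⇒∣m*n y (parity-spec x)) (Signed.∣n⇒∣m*n ⟦ p ⟧ (parity-spec y))) (⟦⟧-∧ p q)))
    where p = parity x ; q = parity y

  parity-neg : ∀ x → parity (- x) ≡ parity x
  parity-neg x = parity-unique (- x) p (subst Even
    (solve 2 (λ x p → :- (x :- p) :- p :* con (+ 2) := :- x :- p) refl x ⟦ p ⟧)
    (Signed.∣m∣n⇒∣m-n (Signed.∣m⇒∣-m (parity-spec x)) (Signed.divides ⟦ p ⟧ refl)))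
    where p = parity x

  parity-≡⇒≡₂ : ∀ {x y} → parity x ≡ parity y → x ≡₂ y
  parity-≡⇒≡₂ {x} {y} px≡py = Signed.∣⇒∣ᵤ (subst Even
    (trans (cong (λ b → (x - ⟦ parity x ⟧) - (y - ⟦ b ⟧)) (sym px≡py))
           (solve 3 (λ x y p → (x :- p) :- (y :- p) := x :- y) refl x y ⟦ parity x ⟧))
    (Signed.∣m∣n⇒∣m-n (parity-spec x) (parity-spec y)))

parity-- : ∀ x y → parity (x - y) ≡ parity x xor parity y
parity-- x y = trans (parity-+ x (- y)) (cong (parity x xor_) (parity-neg y))

parity-sumFin : ∀ n (f : Fin n → ℤ) → parity (sumFin n f) ≡ sum (parity ∘ f)
parity-sumFin zero    f = refl
parity-sumFin (suc n) f = trans (parity-+ (f zero) _) (cong (parity (f zero) xor_) (parity-sumFin n (f ∘ suc)))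

parity-sgn : ∀ k → parity (sgn k) ≡ true
parity-sgn zero    = refl
parity-sgn (suc k) = trans (parity-neg (sgn k)) (parity-sgn k)

-- Determinants over 𝔽₂

Matrix : ℕ → Set
Matrix n = Vector (Vector Bool n) n

infix 4 _≋_
_≋_ : Matrix n → Matrix n → Set
A ≋ B = ∀ i j → A i j ≡ B i j

minor : Matrix (suc n) → Fin (suc n) → Matrix n
minor M j i k = M (suc i) (punchIn j k)

det₂ : Matrix n → Bool
det₂ {zero}  M = true
det₂ {suc n} M = sum λ j → M zero j ∧ det₂ (minor M j)

det₂-cong : {A B : Matrix n} → A ≋ B → det₂ A ≡ det₂ B
det₂-cong {zero}  A≋B = refl
det₂-cong {suc n} A≋B = sum-cong-≗ λ j → cong₂ _∧_ (A≋B zero j) (det₂-cong λ i k → A≋B (suc i) (punchIn j k))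

parity-det : ∀ n (M : Fin n → Fin n → ℤ) → parity (det n M) ≡ det₂ (λ i j → parity (M i j))
parity-det zero    M = refl
parity-det (suc n) M = trans (parity-sumFin (suc n) λ j → sgn (toℕ j) * (M zero j * det n (ℤ-minor j))) (sum-cong-≗ λ j → begin
  parity (sgn (toℕ j) * (M zero j * det n (ℤ-minor j)))         ≡⟨ parity-* (sgn (toℕ j)) _ ⟩
  parity (sgn (toℕ j)) ∧ parity (M zero j * det n (ℤ-minor j))  ≡⟨ cong₂ _∧_ (parity-sgn (toℕ j)) (parity-* (M zero j) _) ⟩
  parity (M zero j) ∧ parity (det n (ℤ-minor j))                ≡⟨ cong (parity (M zero j) ∧_) (parity-det n (ℤ-minor j)) ⟩
  parity (M zero j) ∧ det₂ (λ i k → parity (ℤ-minor j i k))     ∎)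
  where
  open ≡-Reasoning
  ℤ-minor : Fin (suc n) → Fin n → Fin n → ℤ
  ℤ-minor j i k = M (suc i) (punchIn j k)

∑-zero : {f : Vector Bool n} → (∀ i → f i ≡ false) → sum f ≡ false
∑-zero {n} f≗0 = trans (sum-cong-≗ f≗0) (sum-replicate-zero n)

xor-cancelˡ : ∀ x y → x xor (x xor y) ≡ y
xor-cancelˡ x y = trans (sym (xor-assoc x x y)) (cong (_xor y) (xor-same x))

Extensional : ((Fin m → Fin n) → Bool) → Set
Extensional R = ∀ {f g} → f ≗ g → R f ≡ R g

-- det₂ (u ∷ v ∷ N) unfolds to expand₂ u v R with R f = det₂ (λ i l → N i (f l)).
expand₂ : (u v : Vector Bool (2 ℕ.+ n)) → ((Fin n → Fin (2 ℕ.+ n)) → Bool) → Bool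
expand₂ u v R = sum λ j → u j ∧ sum λ k → v (punchIn j k) ∧ R (punchIn j ∘ punchIn k)

leading trailing : (u v : Vector Bool (2 ℕ.+ n)) → ((Fin n → Fin (2 ℕ.+ n)) → Bool) → Bool
leading u v R = u zero ∧ sum λ k → v (suc k) ∧ R (suc ∘ punchIn k)
trailing u v R = sum λ j → u (suc j) ∧ sum λ k → v (suc (punchIn j k)) ∧ R (punchIn (suc j) ∘ punchIn (suc k))

expand₂-split : ∀ u v (R : (Fin n → Fin (2 ℕ.+ n)) → Bool) →
                expand₂ u v R ≡ leading u v R xor (leading v u R xor trailing u v R)
expand₂-split u v R = cong (leading u v R xor_) (begin
  sum (λ j → u (suc j) ∧ ((v zero ∧ R (suc ∘ punchIn j)) xor tail-term j))
    ≡⟨ sum-cong-≗ (λ j → ∧-distribˡ-xor (u (suc j)) (v zero ∧ R (suc ∘ punchIn j)) (tail-term j)) ⟩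
  sum (λ j → (u (suc j) ∧ (v zero ∧ R (suc ∘ punchIn j))) xor (u (suc j) ∧ tail-term j))
    ≡⟨ ∑-distrib-+ (λ j → u (suc j) ∧ (v zero ∧ R (suc ∘ punchIn j))) (λ j → u (suc j) ∧ tail-term j) ⟩
  sum (λ j → u (suc j) ∧ (v zero ∧ R (suc ∘ punchIn j))) xor trailing u v R
    ≡⟨ cong (_xor trailing u v R) (sum-cong-≗ λ j → ∧.x∙yz≈y∙xz (u (suc j)) (v zero) (R (suc ∘ punchIn j))) ⟩
  sum (λ j → v zero ∧ (u (suc j) ∧ R (suc ∘ punchIn j))) xor trailing u v R
    ≡⟨ cong (_xor trailing u v R) (sym (*-distribˡ-sum (v zero) λ j → u (suc j) ∧ R (suc ∘ punchIn j))) ⟩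
  leading v u R xor trailing u v R ∎)
  where
  open ≡-Reasoning
  tail-term : Fin (suc _) → Bool
  tail-term j = sum λ k → v (suc (punchIn j k)) ∧ R (punchIn (suc j) ∘ punchIn (suc k))

trailing-zero : ∀ u v (R : (Fin 0 → Fin 2) → Bool) → trailing u v R ≡ false
trailing-zero u v R = cong (_xor false) (∧-zeroʳ (u (suc zero)))

trailing-suc : ∀ u v {R : (Fin (suc n) → Fin (3 ℕ.+ n)) → Bool} → Extensional R →
               trailing u v R ≡ expand₂ (tail u) (tail v) (R ∘ lift 1)
trailing-suc u v R-ext = sum-cong-≗ λ j → cong (u (suc j) ∧_) (sum-cong-≗ λ k →
  cong (v (suc (punchIn j k)) ∧_) (R-ext {f = punchIn (suc j) ∘ punchIn (suc k)} {g = lift 1 (punchIn j ∘ punchIn k)} λ { zero → refl ; (suc l) → refl }))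

lift-extensional : {R : (Fin (suc n) → Fin (3 ℕ.+ n)) → Bool} → Extensional R → Extensional (R ∘ lift 1)
lift-extensional R-ext f≗g = R-ext λ { zero → refl ; (suc l) → cong suc (f≗g l) }

expand₂-comm : ∀ {R : (Fin n → Fin (2 ℕ.+ n)) → Bool} → Extensional R → ∀ u v → expand₂ u v R ≡ expand₂ v u R
trailing-comm : ∀ {R : (Fin n → Fin (2 ℕ.+ n)) → Bool} → Extensional R → ∀ u v → trailing u v R ≡ trailing v u R

expand₂-comm {R = R} R-ext u v = begin
  expand₂ u v R                                        ≡⟨ expand₂-split u v R ⟩
  leading u v R xor (leading v u R xor trailing u v R) ≡⟨ cong (λ t → leading u v R xor (leading v u R xor t)) (trailing-comm R-ext u v) ⟩
  leading u v R xor (leading v u R xor trailing v u R) ≡⟨ ⊕.x∙yz≈y∙xz (leading u v R) (leading v u R) (trailing v u R) ⟩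
  leading v u R xor (leading u v R xor trailing v u R) ≡⟨ sym (expand₂-split v u R) ⟩
  expand₂ v u R                                        ∎
  where open ≡-Reasoning

trailing-comm {zero}  {R} R-ext u v = trans (trailing-zero u v R) (sym (trailing-zero v u R))
trailing-comm {suc n} {R} R-ext u v = begin
  trailing u v R                            ≡⟨ trailing-suc u v R-ext ⟩
  expand₂ (tail u) (tail v) (R ∘ lift 1)    ≡⟨ expand₂-comm (lift-extensional R-ext) (tail u) (tail v) ⟩
  expand₂ (tail v) (tail u) (R ∘ lift 1)    ≡⟨ sym (trailing-suc v u R-ext) ⟩
  trailing v u R                            ∎
  where open ≡-Reasoning

expand₂-self : ∀ {R : (Fin n → Fin (2 ℕ.+ n)) → Bool} → Extensional R → ∀ u → expand₂ u u R ≡ false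
expand₂-self {zero}  {R} R-ext u = trans (expand₂-split u u R) (trans (xor-cancelˡ (leading u u R) _) (trailing-zero u u R))
expand₂-self {suc n} {R} R-ext u = begin
  expand₂ u u R                     ≡⟨ expand₂-split u u R ⟩
  leading u u R xor (leading u u R xor trailing u u R) ≡⟨ xor-cancelˡ (leading u u R) _ ⟩
  trailing u u R                    ≡⟨ trailing-suc u u R-ext ⟩
  expand₂ (tail u) (tail u) (R ∘ lift 1) ≡⟨ expand₂-self (lift-extensional R-ext) (tail u) ⟩
  false                             ∎
  where open ≡-Reasoning

det₂-restriction-extensional : (N : Vector (Vector Bool m) n) → Extensional (λ (f : Fin n → Fin m) → det₂ (λ i l → N i (f l)))
det₂-restriction-extensional N f≗g = det₂-cong λ i l → cong (N i) (f≗g l)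

det₂-swap₀₁ : ∀ u v (N : Vector (Vector Bool (2 ℕ.+ n)) n) → det₂ (u Vector.∷ v Vector.∷ N) ≡ det₂ (v Vector.∷ u Vector.∷ N)
det₂-swap₀₁ u v N = expand₂-comm (det₂-restriction-extensional N) u v

det₂-repeat₀₁ : ∀ u (N : Vector (Vector Bool (2 ℕ.+ n)) n) → det₂ (u Vector.∷ u Vector.∷ N) ≡ false
det₂-repeat₀₁ u N = expand₂-self (det₂-restriction-extensional N) u

det₂-equal-row₀ : (M : Matrix (suc n)) (s : Fin n) → M zero ≗ M (suc s) → det₂ M ≡ false
det₂-equal-row₀ {suc n} M zero M₀≗M₁ = trans (det₂-cong M≋) (det₂-repeat₀₁ (M zero) (tail (tail M)))
  where
  M≋ : M ≋ (M zero Vector.∷ M zero Vector.∷ tail (tail M))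
  M≋ zero          j = refl
  M≋ (suc zero)    j = sym (M₀≗M₁ j)
  M≋ (suc (suc i)) j = refl
det₂-equal-row₀ {suc n} M (suc s) M₀≗Mₛ = begin
  det₂ M         ≡⟨ det₂-swap₀₁ (M zero) (M (suc zero)) (tail (tail M)) ⟩
  det₂ swapped   ≡⟨ ∑-zero (λ j → trans (cong (M (suc zero) j ∧_) (det₂-equal-row₀ (minor swapped j) s (M₀≗Mₛ ∘ punchIn j)))
                                        (∧-zeroʳ _)) ⟩
  false          ∎
  where
  open ≡-Reasoning
  swapped : Matrix (2 ℕ.+ n)
  swapped = M (suc zero) Vector.∷ M zero Vector.∷ tail (tail M)

det₂-equal-rows : (M : Matrix n) {r s : Fin n} → r ≢ s → M r ≗ M s → det₂ M ≡ false
det₂-equal-rows M {zero}  {zero}  r≢s _ = contradiction refl r≢s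
det₂-equal-rows M {zero}  {suc s} _ Mᵣ≗Mₛ = det₂-equal-row₀ M s Mᵣ≗Mₛ
det₂-equal-rows M {suc r} {zero}  _ Mᵣ≗Mₛ = det₂-equal-row₀ M r (sym ∘ Mᵣ≗Mₛ)
det₂-equal-rows M {suc r} {suc s} r≢s Mᵣ≗Mₛ = ∑-zero λ j →
  trans (cong (M zero j ∧_) (det₂-equal-rows (minor M j) (r≢s ∘ cong suc) (Mᵣ≗Mₛ ∘ punchIn j))) (∧-zeroʳ _)

-- Row operations and triangular matrices

_[_]≔_ : Matrix n → Fin n → Vector Bool n → Matrix n
M [ s ]≔ u = updateAt M s (const u)

minor-≔ : (M : Matrix (suc n)) (s : Fin n) (w : Vector Bool (suc n)) (j : Fin (suc n)) →
          minor (M [ suc s ]≔ w) j ≋ (minor M j [ s ]≔ (w ∘ punchIn j))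
minor-≔ M s w j i = cong-app (map-updateAt {f = _∘ punchIn j} {g = const w} (λ _ → refl) (tail M) s i)

det₂-≔-suc : (M : Matrix (suc n)) (s : Fin n) (w : Vector Bool (suc n)) →
             det₂ (M [ suc s ]≔ w) ≡ sum λ j → M zero j ∧ det₂ (minor M j [ s ]≔ (w ∘ punchIn j))
det₂-≔-suc M s w = sum-cong-≗ λ j → cong (M zero j ∧_) (det₂-cong (minor-≔ M s w j))

det₂-≔-xor : (M : Matrix n) (s : Fin n) (u v : Vector Bool n) →
             det₂ (M [ s ]≔ zipWith _xor_ u v) ≡ det₂ (M [ s ]≔ u) xor det₂ (M [ s ]≔ v)
det₂-≔-xor {suc n} M zero u v =
  trans (sum-cong-≗ λ j → ∧-distribʳ-xor (det₂ (minor M j)) (u j) (v j))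
        (∑-distrib-+ (λ j → u j ∧ det₂ (minor M j)) (λ j → v j ∧ det₂ (minor M j)))
det₂-≔-xor {suc n} M (suc s) u v = begin
  det₂ (M [ suc s ]≔ zipWith _xor_ u v)                          ≡⟨ det₂-≔-suc M s (zipWith _xor_ u v) ⟩
  sum (λ j → M zero j ∧ det₂ (minor M j [ s ]≔ zipWith _xor_ (u ∘ punchIn j) (v ∘ punchIn j)))
    ≡⟨ sum-cong-≗ (λ j → cong (M zero j ∧_) (det₂-≔-xor (minor M j) s (u ∘ punchIn j) (v ∘ punchIn j))) ⟩
  sum (λ j → M zero j ∧ (restricted u j xor restricted v j))     ≡⟨ sum-cong-≗ (λ j → ∧-distribˡ-xor (M zero j) (restricted u j) (restricted v j)) ⟩
  sum (λ j → (M zero j ∧ restricted u j) xor (M zero j ∧ restricted v j))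
    ≡⟨ ∑-distrib-+ (λ j → M zero j ∧ restricted u j) (λ j → M zero j ∧ restricted v j) ⟩
  sum (λ j → M zero j ∧ restricted u j) xor sum (λ j → M zero j ∧ restricted v j)
    ≡⟨ sym (cong₂ _xor_ (det₂-≔-suc M s u) (det₂-≔-suc M s v)) ⟩
  det₂ (M [ suc s ]≔ u) xor det₂ (M [ suc s ]≔ v)                ∎
  where
  open ≡-Reasoning
  restricted : Vector Bool (suc n) → Fin (suc n) → Bool
  restricted w j = det₂ (minor M j [ s ]≔ (w ∘ punchIn j))

addRow : Fin n × Fin n → Matrix n → Matrix n
addRow (r , s) M = M [ s ]≔ zipWith _xor_ (M s) (M r)

det₂-addRow : (M : Matrix n) {r s : Fin n} → r ≢ s → det₂ (addRow (r , s) M) ≡ det₂ M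
det₂-addRow M {r} {s} r≢s = begin
  det₂ (addRow (r , s) M)                        ≡⟨ det₂-≔-xor M s (M s) (M r) ⟩
  det₂ (M [ s ]≔ M s) xor det₂ (M [ s ]≔ M r)    ≡⟨ cong₂ _xor_ (det₂-cong (cong-app ∘ updateAt-id-local s M refl))
                                                                 (det₂-equal-rows (M [ s ]≔ M r) r≢s row-r≗row-s) ⟩
  det₂ M xor false                               ≡⟨ xor-identityʳ (det₂ M) ⟩
  det₂ M                                         ∎
  where
  open ≡-Reasoning
  row-r≗row-s : (M [ s ]≔ M r) r ≗ (M [ s ]≔ M r) s
  row-r≗row-s = cong-app (trans (updateAt-minimal r s M r≢s) (sym (updateAt-updates s M)))

rowOps : List (Fin n × Fin n) → Matrix n → Matrix n
rowOps ops M = List.foldr addRow M ops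

det₂-rowOps : (ops : List (Fin n × Fin n)) → All (uncurry _≢_) ops → (M : Matrix n) → det₂ (rowOps ops M) ≡ det₂ M
det₂-rowOps []              []                 M = refl
det₂-rowOps ((r , s) ∷ ops) (r≢s ∷ distinct) M = trans (det₂-addRow (rowOps ops M) r≢s) (det₂-rowOps ops distinct M)

infixl 7 _·_
_·_ : Matrix n → Matrix n → Matrix n
(A · B) i j = sum λ k → A i k ∧ B k j

·-cong : {A A′ B B′ : Matrix n} → A ≋ A′ → B ≋ B′ → A · B ≋ A′ · B′
·-cong A≋A′ B≋B′ i j = sum-cong-≗ λ k → cong₂ _∧_ (A≋A′ i k) (B≋B′ k j)

·-assoc : (A B C : Matrix n) → A · B · C ≋ A · (B · C)
·-assoc A B C i j = begin
  sum (λ l → sum (λ k → A i k ∧ B k l) ∧ C l j)     ≡⟨ sum-cong-≗ (λ l → *-distribʳ-sum (C l j) (λ k → A i k ∧ B k l)) ⟩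
  sum (λ l → sum (λ k → (A i k ∧ B k l) ∧ C l j))   ≡⟨ sum-cong-≗ (λ l → sum-cong-≗ λ k → ∧-assoc (A i k) (B k l) (C l j)) ⟩
  sum (λ l → sum (λ k → A i k ∧ (B k l ∧ C l j)))   ≡⟨ ∑-comm (λ l k → A i k ∧ (B k l ∧ C l j)) ⟩
  sum (λ k → sum (λ l → A i k ∧ (B k l ∧ C l j)))   ≡⟨ sum-cong-≗ (λ k → sym (*-distribˡ-sum (A i k) (λ l → B k l ∧ C l j))) ⟩
  sum (λ k → A i k ∧ sum (λ l → B k l ∧ C l j))     ∎
  where open ≡-Reasoning

δ : Matrix n
δ zero    zero    = true
δ zero    (suc _) = false
δ (suc _) zero    = false
δ (suc i) (suc j) = δ i j

δ-sym : (i j : Fin n) → δ i j ≡ δ j i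
δ-sym zero    zero    = refl
δ-sym zero    (suc _) = refl
δ-sym (suc _) zero    = refl
δ-sym (suc i) (suc j) = δ-sym i j

∑-δ : (i : Fin n) (f : Vector Bool n) → sum (λ k → δ i k ∧ f k) ≡ f i
∑-δ {suc n} zero    f = trans (cong (f zero xor_) (∑-zero {n} λ _ → refl)) (xor-identityʳ (f zero))
∑-δ {suc n} (suc i) f = ∑-δ i (f ∘ suc)

∑-δ′ : (i : Fin n) (f : Vector Bool n) → sum (λ k → f k ∧ δ k i) ≡ f i
∑-δ′ i f = trans (sum-cong-≗ λ k → trans (∧-comm (f k) (δ k i)) (cong (_∧ f k) (δ-sym k i))) (∑-δ i f)

·-identityˡ : (A : Matrix n) → δ · A ≋ A
·-identityˡ A i j = ∑-δ i (λ k → A k j)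

·-identityʳ : (A : Matrix n) → A · δ ≋ A
·-identityʳ A i j = ∑-δ′ j (A i)

det₂-δ : det₂ (δ {n}) ≡ true
det₂-δ {zero}  = refl
det₂-δ {suc n} = cong₂ _xor_ (det₂-δ {n}) (∑-zero {n} λ _ → refl)

addRow-cong : (o : Fin n × Fin n) {A B : Matrix n} → A ≋ B → addRow o A ≋ addRow o B
addRow-cong (r , s) {A} {B} A≋B i j with i ≟ s
... | yes refl = trans (cong-app (updateAt-updates s A) j)
                 (trans (cong₂ _xor_ (A≋B s j) (A≋B r j)) (sym (cong-app (updateAt-updates s B) j)))
... | no  i≢s  = trans (cong-app (updateAt-minimal i s A i≢s) j)
                 (trans (A≋B i j) (sym (cong-app (updateAt-minimal i s B i≢s) j)))

addRow-· : (o : Fin n × Fin n) (A B : Matrix n) → addRow o (A · B) ≋ addRow o A · B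
addRow-· (r , s) A B i j with i ≟ s
... | yes refl = begin
  addRow (r , s) (A · B) s j                    ≡⟨ cong-app (updateAt-updates s (A · B)) j ⟩
  (A · B) s j xor (A · B) r j                   ≡⟨ sym (∑-distrib-+ (λ k → A s k ∧ B k j) (λ k → A r k ∧ B k j)) ⟩
  sum (λ k → (A s k ∧ B k j) xor (A r k ∧ B k j)) ≡⟨ sum-cong-≗ (λ k → sym (∧-distribʳ-xor (B k j) (A s k) (A r k))) ⟩
  sum (λ k → (A s k xor A r k) ∧ B k j)         ≡⟨ sum-cong-≗ (λ k → cong (_∧ B k j) (sym (cong-app (updateAt-updates s A) k))) ⟩
  (addRow (r , s) A · B) s j                    ∎
  where open ≡-Reasoning
... | no  i≢s  = trans (cong-app (updateAt-minimal i s (A · B) i≢s) j)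
                 (sum-cong-≗ λ k → cong (_∧ B k j) (sym (cong-app (updateAt-minimal i s A i≢s) k)))

rowOps-· : (ops : List (Fin n × Fin n)) (A B : Matrix n) → rowOps ops (A · B) ≋ rowOps ops A · B
rowOps-· []        A B i j = refl
rowOps-· (o ∷ ops) A B i j = trans (addRow-cong o (rowOps-· ops A B) i j) (addRow-· o (rowOps ops A) B i j)

UpperTriangular : Matrix n → Set
UpperTriangular T = ∀ i j → j < i → T i j ≡ false

diagonalProduct : Matrix n → Bool
diagonalProduct T = Vector.foldr _∧_ true λ i → T i i

det₂-∷-combination : ∀ c u (t : Vector Bool n) (N : Vector (Vector Bool (suc n)) n) →
                 det₂ ((λ j → (c ∧ u j) xor sum (λ k → t k ∧ N k j)) Vector.∷ N) ≡ c ∧ det₂ (u Vector.∷ N)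
det₂-∷-combination c u t N = begin
  sum (λ j → ((c ∧ u j) xor combination j) ∧ cofactor j)
    ≡⟨ sum-cong-≗ (λ j → ∧-distribʳ-xor (cofactor j) (c ∧ u j) (combination j)) ⟩
  sum (λ j → ((c ∧ u j) ∧ cofactor j) xor (combination j ∧ cofactor j))
    ≡⟨ ∑-distrib-+ (λ j → (c ∧ u j) ∧ cofactor j) (λ j → combination j ∧ cofactor j) ⟩
  sum (λ j → (c ∧ u j) ∧ cofactor j) xor sum (λ j → combination j ∧ cofactor j)
    ≡⟨ cong₂ _xor_ scaled combination-vanishes ⟩
  (c ∧ det₂ (u Vector.∷ N)) xor false
    ≡⟨ xor-identityʳ _ ⟩
  c ∧ det₂ (u Vector.∷ N) ∎
  where
  open ≡-Reasoning
  combination cofactor : Vector Bool (suc _)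
  combination j = sum λ k → t k ∧ N k j
  cofactor j = det₂ λ i k → N i (punchIn j k)
  scaled : sum (λ j → (c ∧ u j) ∧ cofactor j) ≡ c ∧ det₂ (u Vector.∷ N)
  scaled = trans (sum-cong-≗ λ j → ∧-assoc c (u j) (cofactor j)) (sym (*-distribˡ-sum c λ j → u j ∧ cofactor j))
  combination-vanishes : sum (λ j → combination j ∧ cofactor j) ≡ false
  combination-vanishes = begin
    sum (λ j → combination j ∧ cofactor j)              ≡⟨ sum-cong-≗ (λ j → *-distribʳ-sum (cofactor j) λ k → t k ∧ N k j) ⟩
    sum (λ j → sum λ k → (t k ∧ N k j) ∧ cofactor j)    ≡⟨ sum-cong-≗ (λ j → sum-cong-≗ λ k → ∧-assoc (t k) (N k j) (cofactor j)) ⟩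
    sum (λ j → sum λ k → t k ∧ (N k j ∧ cofactor j))    ≡⟨ ∑-comm (λ j k → t k ∧ (N k j ∧ cofactor j)) ⟩
    sum (λ k → sum λ j → t k ∧ (N k j ∧ cofactor j))    ≡⟨ sum-cong-≗ (λ k → sym (*-distribˡ-sum (t k) λ j → N k j ∧ cofactor j)) ⟩
    sum (λ k → t k ∧ det₂ (N k Vector.∷ N))             ≡⟨ ∑-zero (λ k → trans (cong (t k ∧_) (det₂-equal-rows (N k Vector.∷ N) {zero} {suc k} (λ ()) λ _ → refl)) (∧-zeroʳ (t k))) ⟩
    false                                               ∎

det₂-upperTriangular-· : {T : Matrix n} → UpperTriangular T → (Q : Matrix n) → det₂ (T · Q) ≡ diagonalProduct T ∧ det₂ Q
det₂-upperTriangular-· {zero}          T-upper Q = refl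
det₂-upperTriangular-· {suc n} {T} T-upper Q = begin
  sum (λ j → (T · Q) zero j ∧ det₂ (minor (T · Q) j))
    ≡⟨ sum-cong-≗ (λ j → cong ((T · Q) zero j ∧_) (trans (det₂-cong (minor-· j)) (det₂-upperTriangular-· T′-upper (minor Q j)))) ⟩
  sum (λ j → (T · Q) zero j ∧ (diagonalProduct T′ ∧ det₂ (minor Q j)))
    ≡⟨ sum-cong-≗ (λ j → ∧.x∙yz≈y∙xz ((T · Q) zero j) (diagonalProduct T′) (det₂ (minor Q j))) ⟩
  sum (λ j → diagonalProduct T′ ∧ ((T · Q) zero j ∧ det₂ (minor Q j)))
    ≡⟨ sym (*-distribˡ-sum (diagonalProduct T′) λ j → (T · Q) zero j ∧ det₂ (minor Q j)) ⟩
  diagonalProduct T′ ∧ det₂ ((T · Q) zero Vector.∷ tail Q)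
    ≡⟨ cong (diagonalProduct T′ ∧_) (det₂-∷-combination (T zero zero) (Q zero) (λ k → T zero (suc k)) (tail Q)) ⟩
  diagonalProduct T′ ∧ (T zero zero ∧ det₂ Q)
    ≡⟨ ∧.x∙yz≈yx∙z (diagonalProduct T′) (T zero zero) (det₂ Q) ⟩
  (T zero zero ∧ diagonalProduct T′) ∧ det₂ Q ∎
  where
  open ≡-Reasoning
  T′ : Matrix n
  T′ i j = T (suc i) (suc j)
  T′-upper : UpperTriangular T′
  T′-upper i j j<i = T-upper (suc i) (suc j) (s≤s j<i)
  minor-· : ∀ j → minor (T · Q) j ≋ T′ · minor Q j
  minor-· j i l = cong (λ x → (x ∧ Q zero (punchIn j l)) xor (T′ · minor Q j) i l) (T-upper (suc i) zero (s≤s z≤n))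

det₂-conjugate : (ops : List (Fin n × Fin n)) → All (uncurry _≢_) ops → {P Q M : Matrix n} →
                 rowOps ops δ ≋ P → Q · P ≋ δ → UpperTriangular (P · M · Q) → det₂ M ≡ diagonalProduct (P · M · Q)
det₂-conjugate {n} ops distinct {P} {Q} {M} ops≋P QP≋δ T-upper = begin
  det₂ M                          ≡⟨ det₂-cong (λ i j → sym (·-identityˡ M i j)) ⟩
  det₂ (δ · M)                    ≡⟨ sym (det₂-rowOps ops distinct (δ · M)) ⟩
  det₂ (rowOps ops (δ · M))       ≡⟨ det₂-cong PM≋TP ⟩
  det₂ (T · P)                    ≡⟨ det₂-upperTriangular-· T-upper P ⟩
  diagonalProduct T ∧ det₂ P      ≡⟨ cong (diagonalProduct T ∧_) det₂-P ⟩
  diagonalProduct T ∧ true        ≡⟨ ∧-identityʳ (diagonalProduct T) ⟩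
  diagonalProduct T               ∎
  where
  open ≡-Reasoning
  T : Matrix _
  T = P · M · Q
  PM≋TP : rowOps ops (δ · M) ≋ T · P
  PM≋TP i j = begin
    rowOps ops (δ · M) i j    ≡⟨ rowOps-· ops δ M i j ⟩
    (rowOps ops δ · M) i j    ≡⟨ ·-cong {B = M} ops≋P (λ _ _ → refl) i j ⟩
    (P · M) i j               ≡⟨ sym (·-identityʳ (P · M) i j) ⟩
    (P · M · δ) i j           ≡⟨ ·-cong {A = P · M} (λ _ _ → refl) (λ k l → sym (QP≋δ k l)) i j ⟩
    (P · M · (Q · P)) i j     ≡⟨ sym (·-assoc (P · M) Q P i j) ⟩
    (T · P) i j               ∎
  det₂-P : det₂ P ≡ true
  det₂-P = trans (sym (det₂-cong ops≋P)) (trans (det₂-rowOps ops distinct δ) (det₂-δ {n}))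

-- Group matrices of 2-groups

UpperUnitriangular : Matrix n → Set
UpperUnitriangular T = UpperTriangular T × (∀ i → T i i ≡ true)

combination : Vector Bool m → (Fin m → Matrix n) → Matrix n
combination a E i j = sum λ g → a g ∧ E g i j

·-combinationˡ : (a : Vector Bool m) (E : Fin m → Matrix n) (B : Matrix n) →
                 combination a E · B ≋ combination a (λ g → E g · B)
·-combinationˡ a E B i j = begin
  sum (λ k → sum (λ g → a g ∧ E g i k) ∧ B k j)     ≡⟨ sum-cong-≗ (λ k → *-distribʳ-sum (B k j) λ g → a g ∧ E g i k) ⟩
  sum (λ k → sum (λ g → (a g ∧ E g i k) ∧ B k j))   ≡⟨ sum-cong-≗ (λ k → sum-cong-≗ λ g → ∧-assoc (a g) (E g i k) (B k j)) ⟩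
  sum (λ k → sum (λ g → a g ∧ (E g i k ∧ B k j)))   ≡⟨ ∑-comm (λ k g → a g ∧ (E g i k ∧ B k j)) ⟩
  sum (λ g → sum (λ k → a g ∧ (E g i k ∧ B k j)))   ≡⟨ sum-cong-≗ (λ g → sym (*-distribˡ-sum (a g) λ k → E g i k ∧ B k j)) ⟩
  sum (λ g → a g ∧ (E g · B) i j)                   ∎
  where open ≡-Reasoning

·-combinationʳ : (A : Matrix n) (a : Vector Bool m) (E : Fin m → Matrix n) →
                 A · combination a E ≋ combination a (λ g → A · E g)
·-combinationʳ A a E i j = begin
  sum (λ k → A i k ∧ sum (λ g → a g ∧ E g k j))     ≡⟨ sum-cong-≗ (λ k → *-distribˡ-sum (A i k) λ g → a g ∧ E g k j) ⟩
  sum (λ k → sum (λ g → A i k ∧ (a g ∧ E g k j)))   ≡⟨ sum-cong-≗ (λ k → sum-cong-≗ λ g → ∧.x∙yz≈y∙xz (A i k) (a g) (E g k j)) ⟩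
  sum (λ k → sum (λ g → a g ∧ (A i k ∧ E g k j)))   ≡⟨ ∑-comm (λ k g → a g ∧ (A i k ∧ E g k j)) ⟩
  sum (λ g → sum (λ k → a g ∧ (A i k ∧ E g k j)))   ≡⟨ sum-cong-≗ (λ g → sym (*-distribˡ-sum (a g) λ k → A i k ∧ E g k j)) ⟩
  sum (λ g → a g ∧ (A · E g) i j)                   ∎
  where open ≡-Reasoning

diagonalProduct-constant : (T : Matrix (suc n)) {c : Bool} → (∀ i → T i i ≡ c) → diagonalProduct T ≡ c
diagonalProduct-constant {zero}  T Tᵢᵢ≡c = trans (∧-identityʳ (T zero zero)) (Tᵢᵢ≡c zero)
diagonalProduct-constant {suc n} T {c} Tᵢᵢ≡c =
  trans (cong₂ _∧_ (Tᵢᵢ≡c zero) (diagonalProduct-constant (λ i j → T (suc i) (suc j)) (Tᵢᵢ≡c ∘ suc))) (∧-idem c)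

groupMatrix : (Fin n → Fin n → Fin n) → Vector Bool n → Matrix n
groupMatrix _⊘_ a h k = a (h ⊘ k)

regularMatrix : (Fin n → Fin n → Fin n) → Fin n → Matrix n
regularMatrix _⊘_ g h k = δ g (h ⊘ k)

groupMatrix-combination : (_⊘_ : Fin n → Fin n → Fin n) (a : Vector Bool n) → groupMatrix _⊘_ a ≋ combination a (regularMatrix _⊘_)
groupMatrix-combination _⊘_ a h k = sym (∑-δ′ (h ⊘ k) a)

-- A conjugation by a product of row additions that makes every regular matrix upper
-- unitriangular.  The last field is bracketed so that deciding it by evaluation is cheap.
record Triangularization (_⊘_ : Fin n → Fin n → Fin n) : Set where
  field
    ops           : List (Fin n × Fin n)
    ops-distinct  : All (uncurry _≢_) ops
    basis inverse : Matrix n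
    rowOps-δ      : rowOps ops δ ≋ basis
    inverse-basis : inverse · basis ≋ δ
    unitriangular : ∀ g → UpperUnitriangular (basis · (regularMatrix _⊘_ g · inverse))

det₂-groupMatrix : {_⊘_ : Fin (suc n) → Fin (suc n) → Fin (suc n)} → Triangularization _⊘_ →
                   (a : Vector Bool (suc n)) → det₂ (groupMatrix _⊘_ a) ≡ sum a
det₂-groupMatrix {_⊘_ = _⊘_} cert a =
  trans (det₂-conjugate ops ops-distinct {basis} {inverse} {groupMatrix _⊘_ a} rowOps-δ inverse-basis T-upper) (diagonalProduct-constant T T-diagonal)
  where
  open Triangularization cert
  T : Matrix _
  T = basis · groupMatrix _⊘_ a · inverse
  E : Fin _ → Matrix _
  E = regularMatrix _⊘_
  T≋ : T ≋ combination a (λ g → basis · (E g · inverse))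
  T≋ i j = begin
    T i j                                               ≡⟨ ·-assoc basis (groupMatrix _⊘_ a) inverse i j ⟩
    (basis · (groupMatrix _⊘_ a · inverse)) i j         ≡⟨ ·-cong {A = basis} (λ _ _ → refl) (·-cong {B = inverse} (groupMatrix-combination _⊘_ a) (λ _ _ → refl)) i j ⟩
    (basis · (combination a E · inverse)) i j           ≡⟨ ·-cong {A = basis} (λ _ _ → refl) (·-combinationˡ a E inverse) i j ⟩
    (basis · combination a (λ g → E g · inverse)) i j   ≡⟨ ·-combinationʳ basis a (λ g → E g · inverse) i j ⟩
    combination a (λ g → basis · (E g · inverse)) i j   ∎
    where open ≡-Reasoning
  T-upper : UpperTriangular T
  T-upper i j j<i = trans (T≋ i j) (∑-zero λ g → trans (cong (a g ∧_) (proj₁ (unitriangular g) i j j<i)) (∧-zeroʳ (a g)))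
  T-diagonal : ∀ i → T i i ≡ sum a
  T-diagonal i = trans (T≋ i i) (sum-cong-≗ λ g → trans (cong (a g ∧_) (proj₂ (unitriangular g) i)) (∧-identityʳ (a g)))

infix 4 _≋?_
_≋?_ : (A B : Matrix n) → Dec (A ≋ B)
A ≋? B = all? λ i → all? λ j → A i j Bool.≟ B i j

upperUnitriangular? : (T : Matrix n) → Dec (UpperUnitriangular T)
upperUnitriangular? T =
  (all? λ i → all? λ j → (j <? i) →-dec (T i j Bool.≟ false)) ×-dec (all? λ i → T i i Bool.≟ true)

distinct? : (ops : List (Fin n × Fin n)) → Dec (All (uncurry _≢_) ops)
distinct? = All.all? λ (r , s) → ¬? (r ≟ s)

oddBinomial : ℕ → ℕ → Bool
oddBinomial n k = (n C k) % 2 ≡ᵇ 1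

_⊖₄_ : Fin 4 → Fin 4 → Fin 4
h ⊖₄ k = (toℕ h ℕ.+ 3 ℕ.* toℕ k) mod 4

-- Row i of the basis is (1 + g)^i in 𝔽₂[C₄]; the Pascal matrix modulo 2 is an involution.
C₄-basis : Matrix 4
C₄-basis i k = oddBinomial (toℕ i) (toℕ k)

C₄-ops : List (Fin 4 × Fin 4)
C₄-ops = (# 0 , # 1) ∷ (# 0 , # 2) ∷ (# 0 , # 3) ∷ (# 1 , # 3) ∷ (# 2 , # 3) ∷ []

C₄-triangularization : Triangularization _⊖₄_
C₄-triangularization = record
  { ops           = C₄-ops
  ; ops-distinct  = from-yes (distinct? C₄-ops)
  ; basis         = C₄-basis
  ; inverse       = C₄-basis
  ; rowOps-δ      = from-yes (rowOps C₄-ops δ ≋? C₄-basis)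
  ; inverse-basis = from-yes (C₄-basis · C₄-basis ≋? δ)
  ; unitriangular = from-yes (all? λ g → upperUnitriangular? (C₄-basis · (regularMatrix _⊖₄_ g · C₄-basis)))
  }

_⊘_ : Fin 16 → Fin 16 → Fin 16
h ⊘ k = mulG h (invG k)

-- Row 4u + v of the basis is (1 + g₁)^v (1 + g₂)^u in 𝔽₂[C₄ ⋊ C₄], again an involution;
-- the row operations are read off a Gaussian elimination of this basis.
G-basis : Matrix 16
G-basis i k = oddBinomial (tOf i) (sOf k) ∧ oddBinomial (sOf i) (tOf k)

G-ops : List (Fin 16 × Fin 16)
G-ops =
  (# 0 , # 1) ∷ (# 0 , # 2) ∷ (# 0 , # 3) ∷ (# 0 , # 4) ∷ (# 0 , # 5) ∷ (# 0 , # 6) ∷ (# 0 , # 7) ∷ (# 0 , # 8) ∷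
  (# 0 , # 9) ∷ (# 0 , # 10) ∷ (# 0 , # 11) ∷ (# 0 , # 12) ∷ (# 0 , # 13) ∷ (# 0 , # 14) ∷ (# 0 , # 15) ∷ (# 4 , # 1) ∷
  (# 1 , # 4) ∷ (# 1 , # 5) ∷ (# 1 , # 6) ∷ (# 1 , # 7) ∷ (# 1 , # 12) ∷ (# 1 , # 13) ∷ (# 1 , # 14) ∷ (# 1 , # 15) ∷
  (# 8 , # 2) ∷ (# 2 , # 8) ∷ (# 2 , # 9) ∷ (# 2 , # 10) ∷ (# 2 , # 11) ∷ (# 2 , # 12) ∷ (# 2 , # 13) ∷ (# 2 , # 14) ∷
  (# 2 , # 15) ∷ (# 12 , # 3) ∷ (# 3 , # 12) ∷ (# 3 , # 13) ∷ (# 3 , # 14) ∷ (# 3 , # 15) ∷ (# 4 , # 1) ∷ (# 4 , # 6) ∷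
  (# 4 , # 9) ∷ (# 4 , # 11) ∷ (# 4 , # 12) ∷ (# 4 , # 14) ∷ (# 5 , # 7) ∷ (# 5 , # 13) ∷ (# 5 , # 15) ∷ (# 9 , # 6) ∷
  (# 6 , # 9) ∷ (# 6 , # 11) ∷ (# 6 , # 13) ∷ (# 6 , # 15) ∷ (# 13 , # 7) ∷ (# 7 , # 13) ∷ (# 7 , # 15) ∷ (# 8 , # 2) ∷
  (# 8 , # 9) ∷ (# 8 , # 12) ∷ (# 8 , # 13) ∷ (# 9 , # 6) ∷ (# 9 , # 11) ∷ (# 9 , # 13) ∷ (# 9 , # 14) ∷ (# 10 , # 11) ∷
  (# 10 , # 14) ∷ (# 10 , # 15) ∷ (# 14 , # 11) ∷ (# 11 , # 14) ∷ (# 11 , # 15) ∷ (# 12 , # 3) ∷ (# 12 , # 13) ∷ (# 12 , # 14) ∷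
  (# 13 , # 7) ∷ (# 14 , # 11) ∷ []

G-triangularization : Triangularization _⊘_
G-triangularization = record
  { ops           = G-ops
  ; ops-distinct  = from-yes (distinct? G-ops)
  ; basis         = G-basis
  ; inverse       = G-basis
  ; rowOps-δ      = from-yes (rowOps G-ops δ ≋? G-basis)
  ; inverse-basis = from-yes (G-basis · G-basis ≋? δ)
  ; unitriangular = from-yes (all? λ g → upperUnitriangular? (G-basis · (regularMatrix _⊘_ g · G-basis)))
  }

-- The parities of the four determinants

∑-+ : ∀ m n (f : ℕ → Bool) → sum {m ℕ.+ n} (f ∘ toℕ) ≡ sum {m} (f ∘ toℕ) xor sum {n} (λ i → f (m ℕ.+ toℕ i))
∑-+ zero    n f = refl
∑-+ (suc m) n f = trans (cong (f 0 xor_) (∑-+ m n (f ∘ suc))) (sym (xor-assoc (f 0) _ _))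

∑-halves : ∀ n (f : ℕ → Bool) → sum {n} (λ i → f (toℕ i) xor f (toℕ i ℕ.+ n)) ≡ sum {n ℕ.+ n} (f ∘ toℕ)
∑-halves n f = begin
  sum {n} (λ i → f (toℕ i) xor f (toℕ i ℕ.+ n))               ≡⟨ ∑-distrib-+ {n} (f ∘ toℕ) (λ i → f (toℕ i ℕ.+ n)) ⟩
  sum {n} (f ∘ toℕ) xor sum {n} (λ i → f (toℕ i ℕ.+ n))       ≡⟨ cong (sum {n} (f ∘ toℕ) xor_) (sum-cong-≗ {n} λ i → cong f (+-comm (toℕ i) n)) ⟩
  sum {n} (f ∘ toℕ) xor sum {n} (λ i → f (n ℕ.+ toℕ i))       ≡⟨ sym (∑-+ n n f) ⟩
  sum {n ℕ.+ n} (f ∘ toℕ)                                     ∎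
  where open ≡-Reasoning

parity-square : ∀ x → parity (x * x) ≡ parity x
parity-square x = trans (parity-* x x) (∧-idem (parity x))

parity-f₀ : ∀ x y z w → parity (f₀ x y z w) ≡ ((parity x xor parity y) xor parity z) xor parity w
parity-f₀ x y z w =
  trans (parity-+ (x * x + y * y + z * z) (w * w)) (cong₂ _xor_
  (trans (parity-+ (x * x + y * y) (z * z)) (cong₂ _xor_
    (trans (parity-+ (x * x) (y * y)) (cong₂ _xor_ (parity-square x) (parity-square y)))
    (parity-square z)))
  (parity-square w))

parity-f₁ : ∀ x y z w → parity (f₁ x y z w) ≡ ((parity x xor parity y) xor parity z) xor parity w
parity-f₁ x y z w =
  trans (parity-- (x * x + y * y - z * z) (w * w)) (cong₂ _xor_
  (trans (parity-- (x * x + y * y) (z * z)) (cong₂ _xor_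
    (trans (parity-+ (x * x) (y * y)) (cong₂ _xor_ (parity-square x) (parity-square y)))
    (parity-square z)))
  (parity-square w))

xor-regroup₈ : ∀ q₀ q₁ q₂ q₃ q₄ q₅ q₆ q₇ →
               (((q₀ xor q₂) xor (q₄ xor q₆)) xor (q₁ xor q₃)) xor (q₅ xor q₇)
               ≡ q₀ xor (q₁ xor (q₂ xor (q₃ xor (q₄ xor (q₅ xor (q₆ xor (q₇ xor false)))))))
xor-regroup₈ = solve 8 (λ q₀ q₁ q₂ q₃ q₄ q₅ q₆ q₇ →
  (((q₀ :+ q₂) :+ (q₄ :+ q₆)) :+ (q₁ :+ q₃)) :+ (q₅ :+ q₇)
  := q₀ :+ (q₁ :+ (q₂ :+ (q₃ :+ (q₄ :+ (q₅ :+ (q₆ :+ (q₇ :+ con false)))))))) refl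
  where open RingSolver (fromCommutativeRing xor-∧-commutativeRing) Bool._≟_ using (solve; _:=_; _:+_; con)

parity-F : (w : Fin 8 → ℤ) → parity (F w) ≡ sum (parity ∘ w)
parity-F w = begin
  parity (F w)              ≡⟨ parity-* factor₀ factor₁ ⟩
  parity factor₀ ∧ parity factor₁
    ≡⟨ cong₂ _∧_ (trans (parity-f₀ (w′ 0 - w′ 2) (w′ 4 - w′ 6) (w′ 1 - w′ 3) (w′ 5 - w′ 7)) (pairs _-_ parity--))
                 (trans (parity-f₁ (w′ 0 + w′ 2) (w′ 4 + w′ 6) (w′ 1 + w′ 3) (w′ 5 + w′ 7)) (pairs _+_ parity-+)) ⟩
  S ∧ S                     ≡⟨ ∧-idem S ⟩
  S                         ≡⟨ xor-regroup₈ (q 0) (q 1) (q 2) (q 3) (q 4) (q 5) (q 6) (q 7) ⟩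
  sum (parity ∘ w)          ∎
  where
  open ≡-Reasoning
  w′ : ℕ → ℤ
  w′ n = w (n mod 8)
  q : ℕ → Bool
  q n = parity (w′ n)
  factor₀ factor₁ : ℤ
  factor₀ = f₀ (w′ 0 - w′ 2) (w′ 4 - w′ 6) (w′ 1 - w′ 3) (w′ 5 - w′ 7)
  factor₁ = f₁ (w′ 0 + w′ 2) (w′ 4 + w′ 6) (w′ 1 + w′ 3) (w′ 5 + w′ 7)
  S : Bool
  S = (((q 0 xor q 2) xor (q 4 xor q 6)) xor (q 1 xor q 3)) xor (q 5 xor q 7)
  pairs : (_∙_ : ℤ → ℤ → ℤ) → (∀ x y → parity (x ∙ y) ≡ parity x xor parity y) →
          ((parity (w′ 0 ∙ w′ 2) xor parity (w′ 4 ∙ w′ 6)) xor parity (w′ 1 ∙ w′ 3)) xor parity (w′ 5 ∙ w′ 7) ≡ S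
  pairs _∙_ hom = cong₂ _xor_ (cong₂ _xor_ (cong₂ _xor_ (hom _ _) (hom _ _)) (hom _ _)) (hom _ _)

-- The explicit det₂-cong step matches the two matrices entrywise; asking the type checker
-- to identify them directly would make it unfold det₂ into all 16! terms.
parity-D-G : (a : Fin 16 → ℤ) → parity (D-G a) ≡ sum (parity ∘ a)
parity-D-G a = trans (parity-det 16 λ h k → a (mulG h (invG k)))
  (trans (det₂-cong {A = λ h k → parity (a (mulG h (invG k)))} {B = groupMatrix _⊘_ (parity ∘ a)} λ _ _ → refl)
         (det₂-groupMatrix G-triangularization (parity ∘ a)))

parity-D-4 : (x : Fin 4 → ℤ) → parity (D-4 x) ≡ sum (parity ∘ x)
parity-D-4 x = trans (parity-det 4 λ h k → x ((toℕ h ℕ.+ 3 ℕ.* toℕ k) mod 4))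
  (trans (det₂-cong {A = λ h k → parity (x ((toℕ h ℕ.+ 3 ℕ.* toℕ k) mod 4))} {B = groupMatrix _⊖₄_ (parity ∘ x)} λ _ _ → refl)
         (det₂-groupMatrix C₄-triangularization (parity ∘ x)))

parity-D-4-folded : (A : ℕ → ℤ) (_∙_ : ℤ → ℤ → ℤ) → (∀ x y → parity (x ∙ y) ≡ parity x xor parity y) →
  parity (D-4 λ i → (A (toℕ i) + A (toℕ i ℕ.+ 8)) ∙ (A (toℕ i ℕ.+ 4) + A (toℕ i ℕ.+ 12))) ≡ sum {16} (parity ∘ A ∘ toℕ)
parity-D-4-folded A _∙_ hom = begin
  parity (D-4 quadruple)                                   ≡⟨ parity-D-4 quadruple ⟩
  sum (parity ∘ quadruple)                                 ≡⟨ sum-cong-≗ parity-quadruple ⟩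
  sum {4} (λ i → pairSum (toℕ i) xor pairSum (toℕ i ℕ.+ 4)) ≡⟨ ∑-halves 4 pairSum ⟩
  sum {8} (pairSum ∘ toℕ)                                  ≡⟨ ∑-halves 8 p ⟩
  sum {16} (p ∘ toℕ)                                       ∎
  where
  open ≡-Reasoning
  p : ℕ → Bool
  p = parity ∘ A
  pairSum : ℕ → Bool
  pairSum n = p n xor p (n ℕ.+ 8)
  quadruple : Fin 4 → ℤ
  quadruple i = (A (toℕ i) + A (toℕ i ℕ.+ 8)) ∙ (A (toℕ i ℕ.+ 4) + A (toℕ i ℕ.+ 12))
  parity-quadruple : ∀ i → parity (quadruple i) ≡ pairSum (toℕ i) xor pairSum (toℕ i ℕ.+ 4)
  parity-quadruple i = trans (hom (A (toℕ i) + A (toℕ i ℕ.+ 8)) (A (toℕ i ℕ.+ 4) + A (toℕ i ℕ.+ 12)))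
    (cong₂ _xor_ (parity-+ (A (toℕ i)) (A (toℕ i ℕ.+ 8)))
                 (trans (parity-+ (A (toℕ i ℕ.+ 4)) (A (toℕ i ℕ.+ 12))) (cong (λ k → p (toℕ i ℕ.+ 4) xor p k) (sym (+-assoc (toℕ i) 4 8)))))

parity-F-folded : (A : ℕ → ℤ) → parity (F λ i → A (toℕ i) - A (toℕ i ℕ.+ 8)) ≡ sum {16} (parity ∘ A ∘ toℕ)
parity-F-folded A = begin
  parity (F λ i → A (toℕ i) - A (toℕ i ℕ.+ 8))            ≡⟨ parity-F (λ i → A (toℕ i) - A (toℕ i ℕ.+ 8)) ⟩
  sum {8} (λ i → parity (A (toℕ i) - A (toℕ i ℕ.+ 8)))    ≡⟨ sum-cong-≗ {8} (λ i → parity-- (A (toℕ i)) (A (toℕ i ℕ.+ 8))) ⟩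
  sum {8} (λ i → parity (A (toℕ i)) xor parity (A (toℕ i ℕ.+ 8))) ≡⟨ ∑-halves 8 (parity ∘ A) ⟩
  sum {16} (parity ∘ A ∘ toℕ)                             ∎
  where open ≡-Reasoning

lemma2p5 : (a : Fin 16 → ℤ) →
    let A : ℕ → ℤ
        A n = a (ix16 n)
        b : Fin 4 → ℤ
        b i = (A (toℕ i) + A (toℕ i Data.Nat.+ 8)) + (A (toℕ i Data.Nat.+ 4) + A (toℕ i Data.Nat.+ 12))
        c : Fin 4 → ℤ
        c i = (A (toℕ i) + A (toℕ i Data.Nat.+ 8)) - (A (toℕ i Data.Nat.+ 4) + A (toℕ i Data.Nat.+ 12))
        d : Fin 8 → ℤ
        d i = A (toℕ i) - A (toℕ i Data.Nat.+ 8)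
    in (D-G a ≡₂ D-4 b) × (D-4 b ≡₂ D-4 c) × (D-4 c ≡₂ F d)
lemma2p5 a =
  parity-≡⇒≡₂ {D-G a} {D-4 b} (trans (parity-D-G a) (sym (parity-D-4-folded A _+_ parity-+))) ,
  parity-≡⇒≡₂ {D-4 b} {D-4 c} (trans (parity-D-4-folded A _+_ parity-+) (sym (parity-D-4-folded A _-_ parity--))) ,
  parity-≡⇒≡₂ {D-4 c} {F d} (trans (parity-D-4-folded A _-_ parity--) (sym (parity-F-folded A)))
  where
  A : ℕ → ℤ
  A n = a (ix16 n)
  b c : Fin 4 → ℤ
  b i = (A (toℕ i) + A (toℕ i ℕ.+ 8)) + (A (toℕ i ℕ.+ 4) + A (toℕ i ℕ.+ 12))
  c i = (A (toℕ i) + A (toℕ i ℕ.+ 8)) - (A (toℕ i ℕ.+ 4) + A (toℕ i ℕ.+ 12))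
  d : Fin 8 → ℤ
  d i = A (toℕ i) - A (toℕ i ℕ.+ 8)
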